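{- If $\vdash_\sigma P$ in the well-bracketing type system, then $\vdash_{\mathrm{seq}(\sigma)}P$ in the sequentiality type system, where $\mathrm{seq}(\sigma)=1$ if $\sigma$ has the form $p^{\mathrm O},\sigma'$ and $\mathrm{seq}(\sigma)=0$ otherwise.
   Context: Asynchronous $\pi$-calculus: processes $P ::= a\langle\tilde b\rangle \mid\ !a(\tilde b).P \mid P|Q \mid (\nu a)P \mid G$, $G ::= \mathbf 0 \mid a(\tilde b).P \mid \tau.P \mid [a=b]G \mid G+G'$, well-sorted under a fixed sorting. Names are of three kinds: output-controlled ($x,y,z$), input-controlled ($u,v,w$) and continuation names ($p,q,r$); $a,b,c$ range over output- and input-controlled names. Every output at an output-controlled name carries a tuple $\tilde a,p$ whose last component is a continuation name and whose other components are not; continuation names are transmitted only in this way. Sequentiality type system (continuation names count as output-controlled names): $\vdash_1 u(\tilde a).P$ if $\vdash_1P$; $\vdash_0 x(\tilde a).P$, $\vdash_0 !x(\tilde a).P$ if $\vdash_1P$; $\vdash_1x\langle\tilde a\rangle$; $\vdash_0u\langle\tilde a\rangle$; $\vdash_\eta(\nu a)P$ if $\vdash_\eta P$; $\vdash_0\mathbf0$; $\vdash_{\eta_1+\eta_2}P|Q$ if $\vdash_{\eta_1}P$, $\vdash_{\eta_2}Q$, $\eta_1+\eta_2\le1$; $\vdash_\eta G_1+G_2$ if $\vdash_\eta G_1,G_2$; $\vdash_\eta\tau.P$ if $\vdash_\eta P$; $\vdash_0[a=b]G$ if $\vdash_0G$. Stacks: sequences $\sigma$ of tagged continuation names $p^{\mathrm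 O}$ (output) or $p^{\mathrm I}$ (input), with tags alternating, ending with an output tag unless empty; each name appears at most once with a given tag, and if a name appears with both tags the input occurrence immediately follows the output one. $|\sigma|$ is the length. Interleaving: $\sigma_1\in\sigma_2\between\sigma_3$ iff $\sigma_1$ is a stack and it is derivable by: $\emptyset\in\emptyset\between\emptyset$; $t,\sigma_1\in\sigma_2\between t,\sigma_3$ and $t,\sigma_1\in t,\sigma_2\between\sigma_3$ whenever $\sigma_1\in\sigma_2\between\sigma_3$, for $t$ of the form $p^{\mathrm O}$ or $p^{\mathrm I}$. Well-bracketing typing $\vdash_\sigma P$: $\vdash_{p^{\mathrm O}}p\langle\tilde a\rangle$; $\vdash_{p^{\mathrm O}}x\langle\tilde a,p\rangle$; $\vdash_\emptyset u\langle\tilde a\rangle$; $\vdash_{q^{\mathrm I},p^{\mathrm O}}q(\tilde a).P$ if $\vdash_{p^{\mathrm O}}P$ and $p\ne q$; $\vdash_\emptyset x(\tilde a,p).P$ and $\vdash_\emptyset !x(\tilde a,p).P$ if $\vdash_{p^{\mathrm O}}P$; $\vdash_{p^{\mathrm O}}u(\tilde a).P$ if $\vdash_{p^{\mathrm O}}P$; $\vdash_\emptyset\mathbf0$; $\vdash_{\xi,\sigma'}(\nu p)P$ if $\vdash_{\xi,p^{\mathrm O},p^{\mathrm I},\sigma'}P$, where $\xi$ is empty or ends with an input-tagged name; $\vdash_\sigma(\nu p)P$ if $\vdash_\sigma P$ and $p\notin\sigma$; $\vdash_\sigma(\nu a)P$ if $\vdash_\sigma P$; $\vdash_\emptyset[a=b]P$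 if $\vdash_\emptyset P$; $\vdash_{\sigma''}P|Q$ if $\vdash_\sigma P$, $\vdash_{\sigma'}Q$ and $\sigma''\in\sigma\between\sigma'$; $\vdash_\sigma\tau.P$ if $\vdash_\sigma P$ and $|\sigma|\le1$; $\vdash_\sigma P+Q$ if $\vdash_\sigma P$, $\vdash_\sigma Q$ and $|\sigma|\le1$. -}

module Defs where

open import Data.Nat using (ℕ; zero; suc; _+_; _≤_)
open import Data.List using (List; []; _∷_; _++_; [_]; length; map)
open import Data.List.Relation.Unary.All using (All)
open import Data.List.Membership.Propositional using (_∈_)
open import Data.List.Relation.Unary.Unique.Propositional using (Unique)
open import Data.Product using (Σ; ∃; _×_; _,_; proj₁; proj₂)
open import Data.Sum using (_⊎_)
open import Relation.Binary.PropositionalEquality using (_≡_; _≢_)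

-- Names: output-controlled (x,y,z), input-controlled (u,v,w),
-- continuation names (p,q,r).  Each kind is an infinite supply indexed by ℕ.

data Name : Set where
  oc : ℕ → Name
  ic : ℕ → Name
  cn : ℕ → Name

data NotCont : Name → Set where
  nc-oc : ∀ {n} → NotCont (oc n)
  nc-ic : ∀ {n} → NotCont (ic n)

-- in the sequentiality system, continuation names count as output-controlled
data OutCtl : Name → Set where
  out-oc : ∀ {n} → OutCtl (oc n)
  out-cn : ∀ {n} → OutCtl (cn n)

-- Processes of the asynchronous π-calculus (named syntax; binders are
-- tuples of names, bound names in input prefixes and ν).

mutual
  data Proc : Set where
    out : Name → List Name → Proc
    rep : Name → List Name → Proc → Proc
    par : Proc → Proc → Proc
    nu  : Name → Proc → Proc
    grd : Guard → Proc

  data Guard : Set where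
    nil   : Guard
    inp   : Name → List Name → Proc → Guard
    tau   : Proc → Guard
    match : Name → Name → Guard → Guard
    sum   : Guard → Guard → Guard

record Sorting : Set₁ where
  field
    Sort   : Set
    sortOf : Name → Sort
    obj    : Sort → List Sort

module _ (S : Sorting) where
  open Sorting S

  Fits : Name → List Name → Set
  Fits a bs = map sortOf bs ≡ obj (sortOf a)

  mutual
    data WellSorted : Proc → Set where
      ws-out : ∀ {a bs} → Fits a bs → WellSorted (out a bs)
      ws-rep : ∀ {a bs P} → Fits a bs → WellSorted P → WellSorted (rep a bs P)
      ws-par : ∀ {P Q} → WellSorted P → WellSorted Q → WellSorted (par P Q)
      ws-nu  : ∀ {a P} → WellSorted P → WellSorted (nu a P)
      ws-grd : ∀ {G} → WellSortedG G → WellSorted (grd G)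

    data WellSortedG : Guard → Set where
      ws-nil   : WellSortedG nil
      ws-inp   : ∀ {a bs P} → Fits a bs → WellSorted P → WellSortedG (inp a bs P)
      ws-tau   : ∀ {P} → WellSorted P → WellSortedG (tau P)
      ws-match : ∀ {a b G} → sortOf a ≡ sortOf b → WellSortedG G → WellSortedG (match a b G)
      ws-sum   : ∀ {G H} → WellSortedG G → WellSortedG H → WellSortedG (sum G H)

ArgsOK : Name → List Name → Set
ArgsOK (oc _) bs = Σ (List Name) λ as → Σ ℕ λ p → (bs ≡ as ++ [ cn p ]) × All NotCont as
ArgsOK (ic _) bs = All NotCont bs
ArgsOK (cn _) bs = All NotCont bs

mutual
  data Disciplined : Proc → Set where
    d-out : ∀ {a bs} → ArgsOK a bs → Disciplined (out a bs)
    d-rep : ∀ {a bs P} → ArgsOK a bs → Disciplined P → Disciplined (rep a bs P)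
    d-par : ∀ {P Q} → Disciplined P → Disciplined Q → Disciplined (par P Q)
    d-nu  : ∀ {a P} → Disciplined P → Disciplined (nu a P)
    d-grd : ∀ {G} → DisciplinedG G → Disciplined (grd G)

  data DisciplinedG : Guard → Set where
    d-nil   : DisciplinedG nil
    d-inp   : ∀ {a bs P} → ArgsOK a bs → Disciplined P → DisciplinedG (inp a bs P)
    d-tau   : ∀ {P} → Disciplined P → DisciplinedG (tau P)
    d-match : ∀ {a b G} → DisciplinedG G → DisciplinedG (match a b G)
    d-sum   : ∀ {G H} → DisciplinedG G → DisciplinedG H → DisciplinedG (sum G H)

data SeqTy : ℕ → Proc → Set where
  s-inU   : ∀ {u as P} → SeqTy 1 P → SeqTy 1 (grd (inp (ic u) as P))
  s-inX   : ∀ {x as P} → OutCtl x → SeqTy 1 P → SeqTy 0 (grd (inp x as P))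
  s-repX  : ∀ {x as P} → OutCtl x → SeqTy 1 P → SeqTy 0 (rep x as P)
  s-outX  : ∀ {x as} → OutCtl x → SeqTy 1 (out x as)
  s-outU  : ∀ {u as} → SeqTy 0 (out (ic u) as)
  s-nu    : ∀ {η a P} → SeqTy η P → SeqTy η (nu a P)
  s-nil   : SeqTy 0 (grd nil)
  s-par   : ∀ {η₁ η₂ P Q} → SeqTy η₁ P → SeqTy η₂ Q → η₁ + η₂ ≤ 1 → SeqTy (η₁ + η₂) (par P Q)
  s-sum   : ∀ {η G H} → SeqTy η (grd G) → SeqTy η (grd H) → SeqTy η (grd (sum G H))
  s-tau   : ∀ {η P} → SeqTy η P → SeqTy η (grd (tau P))
  s-match : ∀ {a b G} → SeqTy 0 (grd G) → SeqTy 0 (grd (match a b G))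

-- Stacks: lists of tagged continuation names (continuation p is cn p,
-- represented by its index p : ℕ).

data Tag : Set where
  O I : Tag

Entry : Set
Entry = Tag × ℕ

Stack : Set
Stack = List Entry

data Alternating : Stack → Set where
  alt-[] : Alternating []
  alt-1  : ∀ {e} → Alternating (e ∷ [])
  alt-∷  : ∀ {e e' σ} → proj₁ e ≢ proj₁ e' → Alternating (e' ∷ σ) → Alternating (e ∷ e' ∷ σ)

EndsOut : Stack → Set
EndsOut σ = (σ ≡ []) ⊎ Σ Stack λ σ₀ → Σ ℕ λ p → σ ≡ σ₀ ++ [ (O , p) ]

BothAdjacent : Stack → Set
BothAdjacent σ = ∀ p → (O , p) ∈ σ → (I , p) ∈ σ →
  Σ Stack λ σ₁ → Σ Stack λ σ₂ → σ ≡ σ₁ ++ (O , p) ∷ (I , p) ∷ σ₂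

record IsStack (σ : Stack) : Set where
  field
    alternating  : Alternating σ
    endsOut      : EndsOut σ
    uniqueTagged : Unique σ
    bothAdjacent : BothAdjacent σ

-- derivation rules of interleaving (without the stack requirement)
data Interleave : Stack → Stack → Stack → Set where
  il-[] : Interleave [] [] []
  il-r  : ∀ {t σ₁ σ₂ σ₃} → Interleave σ₁ σ₂ σ₃ → Interleave (t ∷ σ₁) σ₂ (t ∷ σ₃)
  il-l  : ∀ {t σ₁ σ₂ σ₃} → Interleave σ₁ σ₂ σ₃ → Interleave (t ∷ σ₁) (t ∷ σ₂) σ₃

_∈_⋈_ : Stack → Stack → Stack → Set
σ₁ ∈ σ₂ ⋈ σ₃ = IsStack σ₁ × Interleave σ₁ σ₂ σ₃

EmptyOrEndsIn : Stack → Set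
EmptyOrEndsIn ξ = (ξ ≡ []) ⊎ Σ Stack λ ξ₀ → Σ ℕ λ q → ξ ≡ ξ₀ ++ [ (I , q) ]

NotIn : ℕ → Stack → Set
NotIn p σ = All (λ e → proj₂ e ≢ p) σ

data WB : Stack → Proc → Set where
  wb-outP   : ∀ {p as} → WB [ (O , p) ] (out (cn p) as)
  wb-outX   : ∀ {x as p} → WB [ (O , p) ] (out (oc x) (as ++ [ cn p ]))
  wb-outU   : ∀ {u as} → WB [] (out (ic u) as)
  wb-inQ    : ∀ {q p as P} → WB [ (O , p) ] P → p ≢ q →
              WB ((I , q) ∷ (O , p) ∷ []) (grd (inp (cn q) as P))
  wb-inX    : ∀ {x as p P} → WB [ (O , p) ] P → WB [] (grd (inp (oc x) (as ++ [ cn p ]) P))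
  wb-repX   : ∀ {x as p P} → WB [ (O , p) ] P → WB [] (rep (oc x) (as ++ [ cn p ]) P)
  wb-inU    : ∀ {u as p P} → WB [ (O , p) ] P → WB [ (O , p) ] (grd (inp (ic u) as P))
  wb-nil    : WB [] (grd nil)
  wb-nuP    : ∀ {ξ σ' p P} → EmptyOrEndsIn ξ →
              IsStack (ξ ++ (O , p) ∷ (I , p) ∷ σ') →
              WB (ξ ++ (O , p) ∷ (I , p) ∷ σ') P → WB (ξ ++ σ') (nu (cn p) P)
  wb-nuP'   : ∀ {σ p P} → WB σ P → NotIn p σ → WB σ (nu (cn p) P)
  wb-nuA    : ∀ {σ a P} → NotCont a → WB σ P → WB σ (nu a P)
  wb-match  : ∀ {a b G} → NotCont a → NotCont b → WB [] (grd G) → WB [] (grd (match a b G))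
  wb-par    : ∀ {σ σ' σ'' P Q} → WB σ P → WB σ' Q → σ'' ∈ σ ⋈ σ' → WB σ'' (par P Q)
  wb-tau    : ∀ {σ P} → WB σ P → length σ ≤ 1 → WB σ (grd (tau P))
  wb-sum    : ∀ {σ G H} → WB σ (grd G) → WB σ (grd H) → length σ ≤ 1 → WB σ (grd (sum G H))

seq : Stack → ℕ
seq ((O , _) ∷ _) = 1
seq _ = 0

{-# OPTIONS --safe #-}
module Submission where

-- Write #O σ and #I σ for the numbers of output- and input-tagged entries
-- of σ.  Every stack σ is balanced: #O σ = seq σ + #I σ, because tags
-- alternate and the last one is an output.  Balance is preserved by
-- (νp), which removes an adjacent pair p^O,p^I, so every typable σ is
-- balanced.  Both counts add up along an interleaving, so for balanced
-- stacks so does seq; this is exactly what the side condition of the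
-- parallel rule of the sequentiality system needs.

open import Defs
open import Data.Nat using (ℕ; suc; _+_; _≤_; z≤n; s≤s)
open import Data.Nat.Properties
  using (+-suc; +-assoc; +-identityʳ; +-cancelʳ-≡; suc-injective; +-commutativeSemigroup)
open import Algebra.Properties.CommutativeSemigroup +-commutativeSemigroup
  using (interchange; x∙yz≈y∙xz)
open import Data.List using ([]; _∷_; _++_; [_])
open import Data.List.Properties using (∷ʳ-injectiveʳ)
open import Data.Product using (_,_)
open import Data.Sum using (inj₁; inj₂)
open import Data.Empty using (⊥-elim)
open import Relation.Nullary using (¬_)
open import Relation.Binary.PropositionalEquality
  using (_≡_; refl; sym; trans; cong; cong₂; subst; module ≡-Reasoning)
open ≡-Reasoning

sameTag : Tag → Tag → ℕ
sameTag O O = 1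
sameTag I I = 1
sameTag _ _ = 0

count : Tag → Stack → ℕ
count t [] = 0
count t ((t′ , _) ∷ σ) = sameTag t t′ + count t σ

Balanced : Stack → Set
Balanced σ = count O σ ≡ seq σ + count I σ

seq≤1 : ∀ σ → seq σ ≤ 1
seq≤1 [] = z≤n
seq≤1 ((O , _) ∷ _) = s≤s z≤n
seq≤1 ((I , _) ∷ _) = z≤n

endsWithInput : Stack → ℕ
endsWithInput [] = 0
endsWithInput ((t , _) ∷ []) = sameTag I t
endsWithInput (_ ∷ e ∷ σ) = endsWithInput (e ∷ σ)

endsWithInput-∷ʳ-output : ∀ σ p → endsWithInput (σ ++ [ (O , p) ]) ≡ 0
endsWithInput-∷ʳ-output [] p = refl
endsWithInput-∷ʳ-output (_ ∷ []) p = refl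
endsWithInput-∷ʳ-output (_ ∷ e ∷ σ) p = endsWithInput-∷ʳ-output (e ∷ σ) p

alternating-balance : ∀ {σ} → Alternating σ →
  count O σ + endsWithInput σ ≡ seq σ + count I σ
alternating-balance alt-[] = refl
alternating-balance (alt-1 {O , _}) = refl
alternating-balance (alt-1 {I , _}) = refl
alternating-balance (alt-∷ {O , _} {O , _} O≢O _) = ⊥-elim (O≢O refl)
alternating-balance (alt-∷ {I , _} {I , _} I≢I _) = ⊥-elim (I≢I refl)
alternating-balance (alt-∷ {O , _} {I , _} _ alt) = cong suc (alternating-balance alt)
alternating-balance (alt-∷ {I , _} {O , _} _ alt) = alternating-balance alt

stack-balanced : ∀ {σ} → IsStack σ → Balanced σ
stack-balanced st with IsStack.endsOut st | alternating-balance (IsStack.alternating st)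
... | inj₁ refl | _ = refl
... | inj₂ (σ₀ , p , refl) | balance = begin
  count O σ                     ≡⟨ sym (+-identityʳ (count O σ)) ⟩
  count O σ + 0                 ≡⟨ cong (count O σ +_) (sym (endsWithInput-∷ʳ-output σ₀ p)) ⟩
  count O σ + endsWithInput σ   ≡⟨ balance ⟩
  seq σ + count I σ             ∎
  where σ = σ₀ ++ [ (O , p) ]

¬EndsOut-∷ʳ-input : ∀ σ q → ¬ EndsOut (σ ++ [ (I , q) ])
¬EndsOut-∷ʳ-input [] q (inj₁ ())
¬EndsOut-∷ʳ-input (_ ∷ _) q (inj₁ ())
¬EndsOut-∷ʳ-input σ q (inj₂ (σ₀ , _ , eq)) with ∷ʳ-injectiveʳ σ σ₀ eq
... | ()

interleave-count : ∀ t {σ σ₁ σ₂} → Interleave σ σ₁ σ₂ →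
  count t σ ≡ count t σ₁ + count t σ₂
interleave-count t il-[] = refl
interleave-count t (il-r {t′ , _} {σ₂ = σ₁} {σ₂} il) =
  trans (cong (sameTag t t′ +_) (interleave-count t il))
        (x∙yz≈y∙xz (sameTag t t′) (count t σ₁) (count t σ₂))
interleave-count t (il-l {t′ , _} {σ₂ = σ₁} {σ₂} il) =
  trans (cong (sameTag t t′ +_) (interleave-count t il))
        (sym (+-assoc (sameTag t t′) (count t σ₁) (count t σ₂)))

interleave-seq : ∀ {σ σ₁ σ₂} → Interleave σ σ₁ σ₂ →
  Balanced σ → Balanced σ₁ → Balanced σ₂ → seq σ ≡ seq σ₁ + seq σ₂
interleave-seq {σ} {σ₁} {σ₂} il b b₁ b₂ = +-cancelʳ-≡ (count I σ) _ _ (begin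
  seq σ + count I σ                                 ≡⟨ sym b ⟩
  count O σ                                         ≡⟨ interleave-count O il ⟩
  count O σ₁ + count O σ₂                           ≡⟨ cong₂ _+_ b₁ b₂ ⟩
  (seq σ₁ + count I σ₁) + (seq σ₂ + count I σ₂)     ≡⟨ interchange (seq σ₁) _ _ _ ⟩
  (seq σ₁ + seq σ₂) + (count I σ₁ + count I σ₂)     ≡⟨ cong (seq σ₁ + seq σ₂ +_) (sym (interleave-count I il)) ⟩
  (seq σ₁ + seq σ₂) + count I σ                     ∎)

count-unbind : ∀ t ξ p σ → count t (ξ ++ (O , p) ∷ (I , p) ∷ σ) ≡ suc (count t (ξ ++ σ))
count-unbind O [] p σ = refl
count-unbind I [] p σ = refl
count-unbind t ((t′ , _) ∷ ξ) p σ =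
  trans (cong (sameTag t t′ +_) (count-unbind t ξ p σ)) (+-suc (sameTag t t′) (count t (ξ ++ σ)))

seq-unbind : ∀ {ξ σ p} → EmptyOrEndsIn ξ → IsStack (ξ ++ (O , p) ∷ (I , p) ∷ σ) →
  seq (ξ ++ (O , p) ∷ (I , p) ∷ σ) ≡ seq (ξ ++ σ)
seq-unbind (inj₂ ([] , _ , refl)) _ = refl
seq-unbind (inj₂ ((O , _) ∷ _ , _ , refl)) _ = refl
seq-unbind (inj₂ ((I , _) ∷ _ , _ , refl)) _ = refl
seq-unbind {σ = []} {p} (inj₁ refl) st =
  ⊥-elim (¬EndsOut-∷ʳ-input [ (O , p) ] p (IsStack.endsOut st))
seq-unbind {σ = (O , _) ∷ _} (inj₁ refl) _ = refl
seq-unbind {σ = (I , _) ∷ _} (inj₁ refl) st with IsStack.alternating st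
... | alt-∷ _ (alt-∷ I≢I _) = ⊥-elim (I≢I refl)

balanced-unbind : ∀ {ξ σ p} → EmptyOrEndsIn ξ → IsStack (ξ ++ (O , p) ∷ (I , p) ∷ σ) →
  Balanced (ξ ++ (O , p) ∷ (I , p) ∷ σ) → Balanced (ξ ++ σ)
balanced-unbind {ξ} {σ} {p} e st b = suc-injective (begin
  suc (count O (ξ ++ σ))                  ≡⟨ sym (count-unbind O ξ p σ) ⟩
  count O (ξ ++ (O , p) ∷ (I , p) ∷ σ)    ≡⟨ b ⟩
  seq (ξ ++ (O , p) ∷ (I , p) ∷ σ) + count I (ξ ++ (O , p) ∷ (I , p) ∷ σ)
                                          ≡⟨ cong₂ _+_ (seq-unbind e st) (count-unbind I ξ p σ) ⟩
  seq (ξ ++ σ) + suc (count I (ξ ++ σ))   ≡⟨ +-suc (seq (ξ ++ σ)) (count I (ξ ++ σ)) ⟩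
  suc (seq (ξ ++ σ) + count I (ξ ++ σ))   ∎)

WB⇒Balanced : ∀ {σ P} → WB σ P → Balanced σ
WB⇒Balanced wb-outP = refl
WB⇒Balanced wb-outX = refl
WB⇒Balanced wb-outU = refl
WB⇒Balanced (wb-inQ _ _) = refl
WB⇒Balanced (wb-inX _) = refl
WB⇒Balanced (wb-repX _) = refl
WB⇒Balanced (wb-inU _) = refl
WB⇒Balanced wb-nil = refl
WB⇒Balanced (wb-nuP e st w) = balanced-unbind e st (WB⇒Balanced w)
WB⇒Balanced (wb-nuP' w _) = WB⇒Balanced w
WB⇒Balanced (wb-nuA _ w) = WB⇒Balanced w
WB⇒Balanced (wb-match _ _ _) = refl
WB⇒Balanced (wb-par _ _ (st , _)) = stack-balanced st
WB⇒Balanced (wb-tau w _) = WB⇒Balanced w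
WB⇒Balanced (wb-sum w _ _) = WB⇒Balanced w

WB⇒SeqTy : ∀ {σ P} → WB σ P → SeqTy (seq σ) P
WB⇒SeqTy wb-outP = s-outX out-cn
WB⇒SeqTy wb-outX = s-outX out-oc
WB⇒SeqTy wb-outU = s-outU
WB⇒SeqTy (wb-inQ w _) = s-inX out-cn (WB⇒SeqTy w)
WB⇒SeqTy (wb-inX w) = s-inX out-oc (WB⇒SeqTy w)
WB⇒SeqTy (wb-repX w) = s-repX out-oc (WB⇒SeqTy w)
WB⇒SeqTy (wb-inU w) = s-inU (WB⇒SeqTy w)
WB⇒SeqTy wb-nil = s-nil
WB⇒SeqTy (wb-nuP e st w) = subst (λ η → SeqTy η _) (seq-unbind e st) (s-nu (WB⇒SeqTy w))
WB⇒SeqTy (wb-nuP' w _) = s-nu (WB⇒SeqTy w)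
WB⇒SeqTy (wb-nuA _ w) = s-nu (WB⇒SeqTy w)
WB⇒SeqTy (wb-match _ _ w) = s-match (WB⇒SeqTy w)
WB⇒SeqTy (wb-par {σ} {σ′} {σ″} w w′ (st , il)) =
  subst (λ η → SeqTy η _) (sym seq-additive)
    (s-par (WB⇒SeqTy w) (WB⇒SeqTy w′) (subst (_≤ 1) seq-additive (seq≤1 σ″)))
  where
  seq-additive : seq σ″ ≡ seq σ + seq σ′
  seq-additive = interleave-seq il (stack-balanced st) (WB⇒Balanced w) (WB⇒Balanced w′)
WB⇒SeqTy (wb-tau w _) = s-tau (WB⇒SeqTy w)
WB⇒SeqTy (wb-sum w w′ _) = s-sum (WB⇒SeqTy w) (WB⇒SeqTy w′)

mainTheorem8 : (S : Sorting) (σ : Stack) (P : Proc) →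
    WellSorted S P → Disciplined P → IsStack σ →
    WB σ P → SeqTy (seq σ) P
mainTheorem8 _ _ _ _ _ _ = WB⇒SeqTy
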